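{- Let $G$ and $H$ be finite, simple, undirected, connected graphs, each having a universal vertex. Then ${\rm dmg}(G\square H)\le \min\{|V(G)|,|V(H)|\}$.
   Context: A universal vertex is a vertex adjacent to all other vertices. The Cartesian product $G\square H$ has vertex set $V(G)\times V(H)$, with $(u,v)\sim(u',v')$ iff ($u=u'$ and $vv'\in E(H)$) or ($v=v'$ and $uu'\in E(G)$). Damage game on a graph: one cop and one robber; in round $0$ the cop chooses a vertex, then the robber does; in each later round the cop moves to an adjacent vertex or passes, then the robber moves to an adjacent vertex or passes; the robber is captured if the cop occupies the robber's vertex. A vertex $v$ is damaged if the robber occupies $v$ in some round $i\ge0$ and in round $i+1$ the uncaptured robber passes or moves to a neighbour. The damage number ${\rm dmg}(\cdot)$ is the number of distinct vertices damaged when the cop plays to minimize and the robber to maximize this number. -}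

module Defs where

open import Level using (0ℓ)
open import Data.Nat using (ℕ; zero; suc; _≤_; _<_)
open import Data.Fin using (Fin)
open import Data.Product using (Σ; ∃; _×_; _,_)
open import Data.Sum using (_⊎_)
open import Data.List using (List; []; _∷_; map; upTo; length)
open import Data.List.Relation.Unary.All using (All)
open import Data.List.Relation.Unary.Unique.Propositional using (Unique)
open import Relation.Nullary using (¬_; Dec)
open import Relation.Binary.PropositionalEquality using (_≡_; _≢_)

record Graph : Set₁ where
  field
    n     : ℕ
    Adj   : Fin n → Fin n → Set
    adj?  : ∀ u v → Dec (Adj u v)
    sym   : ∀ {u v} → Adj u v → Adj v u
    irrefl : ∀ {u} → ¬ Adj u u

open Graph public

∣V∣ : Graph → ℕ
∣V∣ G = n G

data Walk {V : Set} (E : V → V → Set) : V → V → Set where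
  here  : ∀ {u} → Walk E u u
  step  : ∀ {u v w} → E u v → Walk E v w → Walk E u w

Connected : Graph → Set
Connected G = ∀ (u v : Fin (n G)) → Walk (Adj G) u v

HasUniversalVertex : Graph → Set
HasUniversalVertex G = Σ (Fin (n G)) λ u → ∀ v → v ≢ u → Adj G u v

□-V : Graph → Graph → Set
□-V G H = Fin (n G) × Fin (n H)

□-Adj : (G H : Graph) → □-V G H → □-V G H → Set
□-Adj G H (u , v) (u' , v') = (u ≡ u' × Adj H v v') ⊎ (v ≡ v' × Adj G u u')

-- A robber play is a sequence r : ℕ → V (r i = robber's vertex in round i).
-- A cop strategy σ maps the robber's history (r 0, …, r (i-1)) to the cop's
-- vertex in round i (σ [] is the cop's round-0 choice).  Against a fixed
-- deterministic cop strategy, robber strategies correspond exactly to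
-- legal robber sequences.

module DamageGame {V : Set} (E : V → V → Set) where

  Move : V → V → Set
  Move x y = x ≡ y ⊎ E x y

  RobberLegal : (ℕ → V) → Set
  RobberLegal r = ∀ i → Move (r i) (r (suc i))

  CopStrategy : Set
  CopStrategy = List V → V

  history : (ℕ → V) → ℕ → List V
  history r i = map r (upTo i)

  cop : CopStrategy → (ℕ → V) → ℕ → V
  cop σ r i = σ (history r i)

  CopLegal : CopStrategy → Set
  CopLegal σ = ∀ r → RobberLegal r → ∀ i → Move (cop σ r i) (cop σ r (suc i))

  -- the robber has not been captured in any round j ≤ i
  -- (round j: cop moves, capturing if it lands on r (j-1); then robber moves,
  -- capture if cop and robber share a vertex)
  UncapturedUpTo : CopStrategy → (ℕ → V) → ℕ → Set
  UncapturedUpTo σ r i =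
    ∀ j → j ≤ i → (cop σ r j ≢ r j) × (∀ k → j ≡ suc k → cop σ r j ≢ r k)

  -- v is damaged: robber occupies v in round i, and in round i+1 the robber
  -- is still uncaptured after the cop's move (so it passes or moves)
  Damaged : CopStrategy → (ℕ → V) → V → Set
  Damaged σ r v = ∃ λ i → r i ≡ v × UncapturedUpTo σ r i × (cop σ r (suc i) ≢ r i)

  DamageAtMost : CopStrategy → (ℕ → V) → ℕ → Set
  DamageAtMost σ r k = ∀ (xs : List V) → Unique xs → All (Damaged σ r) xs → length xs ≤ k

  DmgAtMost : ℕ → Set
  DmgAtMost k = Σ CopStrategy λ σ → CopLegal σ × (∀ r → RobberLegal r → DamageAtMost σ r k)

dmg□≤ : Graph → Graph → ℕ → Set
dmg□≤ G H k = DamageGame.DmgAtMost (□-Adj G H) k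

-- Let u and w be universal vertices of G and H.  The cop starts at (u , w) and, as soon
-- as the robber escapes capture, keeps to the row V(G) × {w}, standing at (a , w) while
-- the robber stands at (a , b).  Since w is universal in H, every robber move that keeps
-- the G-coordinate a (including passing) ends next to the cop, so the robber can only move
-- along G, keeping b, and the cop follows it along the row.  Hence every damaged vertex lies
-- in a single fibre V(G) × {b}, so dmg(G □ H) ≤ |V(G)|, and |V(H)| by the symmetry of □.
module Submission where

open import Defs
open import Data.Nat using (ℕ; zero; suc; _≤_; _⊓_)
open import Data.Nat.Properties using (⊓-sel; ≤-refl; m≤n⇒m≤1+n)
open import Data.Fin using (Fin; zero; suc; _≟_)
open import Data.Fin.Properties using (injective⇒≤)
open import Data.Product using (_×_; _,_; proj₁; proj₂; swap)
open import Data.Product.Properties using (≡-dec)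
open import Data.Sum as Sum using (_⊎_; inj₁; inj₂)
open import Data.Empty using (⊥-elim)
open import Data.List using (List; []; _∷_; [_]; map; upTo; length; foldl; lookup; _∷ʳ_)
open import Data.List.Properties using (upTo-∷ʳ; foldl-∷ʳ; map-++; map-∘; length-map)
open import Data.List.Membership.Propositional.Properties using (∈-lookup)
open import Data.List.Relation.Unary.All as All using (All; []; _∷_)
open import Data.List.Relation.Unary.All.Properties using (map⁺)
open import Data.List.Relation.Unary.Unique.Propositional using (Unique; _∷_)
import Data.List.Relation.Unary.Unique.Propositional.Properties as Unique
open import Function using (_∘_)
open import Function.Definitions using (Injective)
open import Relation.Nullary using (Dec; yes; no)
open import Relation.Nullary.Decidable using (_⊎-dec_; _×-dec_)
open import Relation.Binary.Definitions using (DecidableEquality)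
open import Relation.Binary.PropositionalEquality
  using (_≡_; _≢_; refl; trans; cong; subst; module ≡-Reasoning) renaming (sym to ≡-sym)

lookup-injective : ∀ {A : Set} {xs : List A} → Unique xs → Injective _≡_ _≡_ (lookup xs)
lookup-injective (_ ∷ _)   {zero}  {zero}  _  = refl
lookup-injective (x∉ ∷ _)  {zero}  {suc j} eq = ⊥-elim (All.lookup x∉ (∈-lookup j) eq)
lookup-injective (x∉ ∷ _)  {suc i} {zero}  eq = ⊥-elim (All.lookup x∉ (∈-lookup i) (≡-sym eq))
lookup-injective (_ ∷ xs!) {suc i} {suc j} eq = cong suc (lookup-injective xs! eq)

Unique⇒length≤ : ∀ {n} {xs : List (Fin n)} → Unique xs → length xs ≤ n
Unique⇒length≤ xs! = injective⇒≤ (lookup-injective xs!)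

map-pair-proj₁ : ∀ {A B : Set} {b : B} {xs : List (A × B)} →
                 All (λ x → proj₂ x ≡ b) xs → map (_, b) (map proj₁ xs) ≡ xs
map-pair-proj₁                    []           = refl
map-pair-proj₁ {xs = (a , _) ∷ _} (refl ∷ xs≡) = cong ((a , _) ∷_) (map-pair-proj₁ xs≡)

Unique-fibre-length≤ : ∀ {n} {B : Set} {b : B} {xs : List (Fin n × B)} →
                       Unique xs → All (λ x → proj₂ x ≡ b) xs → length xs ≤ n
Unique-fibre-length≤ {xs = xs} xs! xs≡ =
  subst (_≤ _) (length-map proj₁ xs)
    (Unique⇒length≤ (Unique.map⁻ (subst Unique (≡-sym (map-pair-proj₁ xs≡)) xs!)))

universal⇒Move : ∀ (G : Graph) {u} → (∀ v → v ≢ u → Adj G u v) → ∀ v → DamageGame.Move (Adj G) u v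
universal⇒Move G {u} univ v with v ≟ u
... | yes refl = inj₁ refl
... | no v≢u   = inj₂ (univ v v≢u)

module □-Moves (G H : Graph) where
  open DamageGame

  □-Adj? : ∀ x y → Dec (□-Adj G H x y)
  □-Adj? (a , b) (a′ , b′) = ((a ≟ a′) ×-dec adj? H b b′) ⊎-dec ((b ≟ b′) ×-dec adj? G a a′)

  □-≟ : DecidableEquality (□-V G H)
  □-≟ = ≡-dec _≟_ _≟_

  □-Move-column : ∀ a {b b′} → Move (Adj H) b b′ → Move (□-Adj G H) (a , b) (a , b′)
  □-Move-column a (inj₁ refl) = inj₁ refl
  □-Move-column a (inj₂ b~b′) = inj₂ (inj₁ (refl , b~b′))

  □-Move-row : ∀ b {a a′} → Move (Adj G) a a′ → Move (□-Adj G H) (a , b) (a′ , b)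
  □-Move-row b (inj₁ refl) = inj₁ refl
  □-Move-row b (inj₂ a~a′) = inj₂ (inj₂ (refl , a~a′))

  □-Move-cases : ∀ {x y} → Move (□-Adj G H) x y →
                 proj₁ x ≡ proj₁ y ⊎ (proj₂ x ≡ proj₂ y × Adj G (proj₁ x) (proj₁ y))
  □-Move-cases (inj₁ refl)             = inj₁ refl
  □-Move-cases (inj₂ (inj₁ (a≡ , _))) = inj₁ a≡
  □-Move-cases (inj₂ (inj₂ b≡a~))     = inj₂ b≡a~

module Memoryless {V : Set} (E : V → V → Set) where
  open DamageGame E

  Move? : DecidableEquality V → (∀ x y → Dec (E x y)) → ∀ x y → Dec (Move x y)
  Move? _≟V_ E? x y = (x ≟V y) ⊎-dec E? x y

  cop-foldl-suc : ∀ (react : V → V → V) c₀ r i →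
                  cop (foldl react c₀) r (suc i) ≡ react (cop (foldl react c₀) r i) (r i)
  cop-foldl-suc react c₀ r i = begin
    foldl react c₀ (map r (upTo (suc i)))    ≡⟨ cong (foldl react c₀ ∘ map r) (≡-sym (upTo-∷ʳ i)) ⟩
    foldl react c₀ (map r (upTo i ∷ʳ i))     ≡⟨ cong (foldl react c₀) (map-++ r (upTo i) [ i ]) ⟩
    foldl react c₀ (map r (upTo i) ∷ʳ r i)   ≡⟨ foldl-∷ʳ react c₀ (r i) (map r (upTo i)) ⟩
    react (foldl react c₀ (map r (upTo i))) (r i) ∎
    where open ≡-Reasoning

  foldl-CopLegal : ∀ {react : V → V → V} c₀ → (∀ c x → Move c (react c x)) → CopLegal (foldl react c₀)
  foldl-CopLegal {react} c₀ react-legal r _ i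
    rewrite cop-foldl-suc react c₀ r i = react-legal _ (r i)

module _ {V W : Set} {E : V → V → Set} {F : W → W → Set}
         (f : V → W) (g : W → V) (g∘f : ∀ x → g (f x) ≡ x)
         (f-hom : ∀ x y → E x y → F (f x) (f y)) (g-hom : ∀ x y → F x y → E (g x) (g y)) where
  private
    module E = DamageGame E
    module F = DamageGame F

    f-Move : ∀ {x y} → E.Move x y → F.Move (f x) (f y)
    f-Move {x} {y} = Sum.map (cong f) (f-hom x y)

    g-Move : ∀ {x y} → F.Move x y → E.Move (g x) (g y)
    g-Move {x} {y} = Sum.map (cong g) (g-hom x y)

    f-injective : Injective _≡_ _≡_ f
    f-injective {x} {y} fx≡fy = trans (≡-sym (g∘f x)) (trans (cong g fx≡fy) (g∘f y))

    g-undoes : ∀ {c x} → c ≡ f x → g c ≡ x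
    g-undoes {x = x} refl = g∘f x

  DmgAtMost-retract : ∀ {k} → F.DmgAtMost k → E.DmgAtMost k
  DmgAtMost-retract {k} (σ′ , σ′-legal , σ′-bound) = σ , σ-legal , σ-bound
    where
    σ : E.CopStrategy
    σ = g ∘ σ′ ∘ map f

    cop-σ : ∀ r i → E.cop σ r i ≡ g (F.cop σ′ (f ∘ r) i)
    cop-σ r i = cong (g ∘ σ′) (≡-sym (map-∘ (upTo i)))

    f-RobberLegal : ∀ {r} → E.RobberLegal r → F.RobberLegal (f ∘ r)
    f-RobberLegal r-legal i = f-Move (r-legal i)

    σ-legal : E.CopLegal σ
    σ-legal r r-legal i rewrite cop-σ r i | cop-σ r (suc i) =
      g-Move (σ′-legal (f ∘ r) (f-RobberLegal r-legal) i)

    f-Damaged : ∀ r {v} → E.Damaged σ r v → F.Damaged σ′ (f ∘ r) (f v)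
    f-Damaged r (i , refl , uncaught , escaped) =
      i , refl ,
      (λ j j≤i → (λ c≡ → proj₁ (uncaught j j≤i) (trans (cop-σ r j) (g-undoes c≡))) ,
                 (λ k j≡ c≡ → proj₂ (uncaught j j≤i) k j≡ (trans (cop-σ r j) (g-undoes c≡)))) ,
      (λ c≡ → escaped (trans (cop-σ r (suc i)) (g-undoes c≡)))

    σ-bound : ∀ r → E.RobberLegal r → E.DamageAtMost σ r k
    σ-bound r r-legal xs xs! damaged = subst (_≤ k) (length-map f xs)
      (σ′-bound (f ∘ r) (f-RobberLegal r-legal) (map f xs)
        (Unique.map⁺ f-injective xs!) (map⁺ (All.map (f-Damaged r) damaged)))

□-Adj-swap : ∀ G H x y → □-Adj G H x y → □-Adj H G (swap x) (swap y)
□-Adj-swap G H _ _ = Sum.swap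

□-swap : ∀ G H {k} → dmg□≤ H G k → dmg□≤ G H k
□-swap G H = DmgAtMost-retract swap swap (λ _ → refl) (□-Adj-swap G H) (□-Adj-swap H G)

module Shadow (G H : Graph) {u} (u-universal : ∀ v → v ≢ u → Adj G u v)
              {w} (w-universal : ∀ v → v ≢ w → Adj H w v) where
  open DamageGame (□-Adj G H)
  open □-Moves G H
  open Memoryless (□-Adj G H)

  move? : ∀ x y → Dec (Move x y)
  move? = Move? □-≟ □-Adj?

  chase : □-V G H → □-V G H → □-V G H
  chase c x with move? c x
  ... | yes _ = x
  ... | no _ with move? c (proj₁ x , w)
  ...   | yes _ = proj₁ x , w
  ...   | no _  = c

  chase-legal : ∀ c x → Move c (chase c x)
  chase-legal c x with move? c x
  ... | yes c→x = c→x
  ... | no _ with move? c (proj₁ x , w)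
  ...   | yes c→row = c→row
  ...   | no _      = inj₁ refl

  chase-captures : ∀ {c x} → Move c x → chase c x ≡ x
  chase-captures {c} {x} c→x with move? c x
  ... | yes _ = refl
  ... | no ¬c→x = ⊥-elim (¬c→x c→x)

  chase-along-row : ∀ {a} x → DamageGame.Move (Adj G) a (proj₁ x) →
                    chase (a , w) x ≢ x → chase (a , w) x ≡ (proj₁ x , w)
  chase-along-row {a} x a→ escaped with move? (a , w) x
  ... | yes _ = ⊥-elim (escaped refl)
  ... | no _ with move? (a , w) (proj₁ x , w)
  ...   | yes _ = refl
  ...   | no ¬a→ = ⊥-elim (¬a→ (□-Move-row w a→))

  column-Move : ∀ {a} x → a ≡ proj₁ x → Move (a , w) x
  column-Move x refl = □-Move-column (proj₁ x) (universal⇒Move H w-universal (proj₂ x))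

  chase-follows : ∀ {x x′} → Move x x′ → chase (proj₁ x , w) x′ ≢ x′ →
                  chase (proj₁ x , w) x′ ≡ (proj₁ x′ , w) × proj₂ x′ ≡ proj₂ x
  chase-follows {x′ = x′} x→x′ escaped with □-Move-cases x→x′
  ... | inj₁ a≡        = ⊥-elim (escaped (chase-captures (column-Move x′ a≡)))
  ... | inj₂ (b≡ , a~) = chase-along-row x′ (inj₂ a~) escaped , ≡-sym b≡

  σ : CopStrategy
  σ = foldl chase (u , w)

  Shadowing : (ℕ → □-V G H) → ℕ → Set
  Shadowing r i = cop σ r (suc i) ≡ (proj₁ (r i) , w) × proj₂ (r i) ≡ proj₂ (r 0)

  shadowing : ∀ r → RobberLegal r → ∀ i → UncapturedUpTo σ r i → cop σ r (suc i) ≢ r i → Shadowing r i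
  shadowing r _ zero _ escaped =
    chase-along-row (r 0) (universal⇒Move G u-universal (proj₁ (r 0))) escaped , refl
  shadowing r r-legal (suc i) uncaught escaped = trans cop-next (proj₁ next) , trans (proj₂ next) b≡
    where
    uncaught-i : UncapturedUpTo σ r i
    uncaught-i j j≤i = uncaught j (m≤n⇒m≤1+n j≤i)

    previous : Shadowing r i
    previous = shadowing r r-legal i uncaught-i (proj₂ (uncaught (suc i) ≤-refl) i refl)

    b≡ : proj₂ (r i) ≡ proj₂ (r 0)
    b≡ = proj₂ previous

    cop-next : cop σ r (suc (suc i)) ≡ chase (proj₁ (r i) , w) (r (suc i))
    cop-next = trans (cop-foldl-suc chase (u , w) r (suc i)) (cong (λ c → chase c (r (suc i))) (proj₁ previous))

    next : chase (proj₁ (r i) , w) (r (suc i)) ≡ (proj₁ (r (suc i)) , w) × proj₂ (r (suc i)) ≡ proj₂ (r i)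
    next = chase-follows (r-legal i) (escaped ∘ trans cop-next)

  σ-dmg≤ : DmgAtMost (n G)
  σ-dmg≤ = σ , foldl-CopLegal (u , w) chase-legal , bound
    where
    bound : ∀ r → RobberLegal r → DamageAtMost σ r (n G)
    bound r r-legal _ xs! damaged = Unique-fibre-length≤ xs! (All.map in-fibre damaged)
      where
      in-fibre : ∀ {v} → Damaged σ r v → proj₂ v ≡ proj₂ (r 0)
      in-fibre (i , refl , uncaught , escaped) = proj₂ (shadowing r r-legal i uncaught escaped)

theorem8 : (G H : Graph) → Connected G → Connected H → HasUniversalVertex G → HasUniversalVertex H → dmg□≤ G H (∣V∣ G ⊓ ∣V∣ H)
theorem8 G H _ _ (_ , u-universal) (_ , w-universal) with ⊓-sel (n G) (n H)
... | inj₁ min≡ = subst (dmg□≤ G H) (≡-sym min≡) (Shadow.σ-dmg≤ G H u-universal w-universal)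
... | inj₂ min≡ = subst (dmg□≤ G H) (≡-sym min≡) (□-swap G H (Shadow.σ-dmg≤ H G w-universal u-universal))
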